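{- For integers $n,k\ge 0$ let $h(n,k)=\binom{2n}{n}\binom{2k}{k}\binom{n+2k}{n}\binom{n}{k}$. Then in a neighborhood of $x=0$, $$\sum_{n=0}^\infty\sum_{k=0}^\infty h(n,k)\,x^{n+k}\bigl\{4x-2n(1-x)+3k(1+4x)\bigr\}=0.$$
   Context: $\binom{n}{k}=0$ for $k>n$, so $h(n,k)=0$ when $k>n$. -}

module Defs where

open import Data.Nat using (ℕ; zero; suc; _+_; _*_; _∸_; _≤?_)
open import Data.Nat.Combinatorics using (_C_)
open import Data.Integer as ℤ using (ℤ; +_; 0ℤ)
open import Relation.Nullary using (yes; no)

-- h(n,k) = C(2n,n) C(2k,k) C(n+2k,n) C(n,k)   (note: C(n,k) = 0 for k > n)
h : ℕ → ℕ → ℕ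
h n k = ((2 * n) C n) * ((2 * k) C k) * ((n + 2 * k) C n) * (n C k)

-- Coefficients of the polynomial  4x - 2n(1-x) + 3k(1+4x)  in x:
--   constant term  3k - 2n,  coefficient of x  4 + 2n + 12k,  others 0.
factorCoeff : ℕ → ℕ → ℕ → ℤ
factorCoeff n k 0 = (+ (3 * k)) ℤ.- (+ (2 * n))
factorCoeff n k 1 = + (4 + 2 * n + 12 * k)
factorCoeff n k (suc (suc _)) = 0ℤ

-- Coefficient of x^m in the term  h(n,k) x^(n+k) {4x - 2n(1-x) + 3k(1+4x)}.
termCoeff : ℕ → ℕ → ℕ → ℤ
termCoeff n k m with n + k ≤? m
... | yes _ = (+ h n k) ℤ.* factorCoeff n k (m ∸ (n + k))
... | no _  = 0ℤ

sumTo : ℕ → (ℕ → ℤ) → ℤ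
sumTo zero f = f 0
sumTo (suc m) f = sumTo m f ℤ.+ f (suc m)

-- Coefficient of x^m in the double series  Σ_n Σ_k h(n,k) x^(n+k) {…}.
-- Only terms with n,k ≤ m contribute (termCoeff vanishes when n+k > m).
seriesCoeff : ℕ → ℤ
seriesCoeff m = sumTo m (λ n → sumTo m (λ k → termCoeff n k m))

-- Write c(m) for the coefficient of x^m.  With P(n,k) = h(n,k)(3k - 2n) and
-- Q(n,k) = h(n,k)(4 + 2n + 12k) the constant and linear parts of the bracket,
-- c(m) = P(0,m) + Σ_{t<m} (Q(t,k) + P(t+1,k)) with k = m - 1 - t.  Setting
-- G(n,k+1) = 6(n+2k+1)(n-k) h(n,k) and G(n,0) = 0, the pair (h, G) is a WZ pair:
--   (n+k+1)(Q(n,k) + P(n+1,k)) = G(n+1,k) - G(n,k+1),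
-- so m c(m) telescopes along the antidiagonal to G(m,0) = 0.  The WZ identity is
-- a polynomial identity once h(n+1,k) and h(n,k+1) are expressed through h(n,k)
-- by the term ratios of the four binomials, which all come from Pascal's rule and
-- the absorption identity (k+1) C(n+1,k+1) = (n+1) C(n,k).
module Submission where

open import Defs
open import Data.Nat as ℕ using (ℕ; zero; suc; _∸_; _≤?_; z≤n; s≤s)
import Data.Nat.Properties as NP
open import Data.Nat.Combinatorics using (_C_; nC1≡n; k>n⇒nCk≡0; nCk+nC[k+1]≡[n+1]C[k+1])
open import Data.Sum using (inj₁; inj₂)
open import Data.List using (_∷_; [])
open import Relation.Nullary using (yes; no; contradiction)
open import Relation.Binary.PropositionalEquality
open ≡-Reasoning

module _ where
  open import Data.Nat using (_+_; _*_)
  open import Data.Nat.Properties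

  [k+1]*[n+1]C[k+1]≡[n+1]*nCk : ∀ n k → suc k * (suc n C suc k) ≡ suc n * (n C k)
  [k+1]*[n+1]C[k+1]≡[n+1]*nCk zero    zero    = refl
  [k+1]*[n+1]C[k+1]≡[n+1]*nCk zero    (suc k) = begin
    suc (suc k) * (1 C suc (suc k)) ≡⟨ cong (suc (suc k) *_) (k>n⇒nCk≡0 (s≤s (s≤s (z≤n {k})))) ⟩
    suc (suc k) * 0                 ≡⟨ *-zeroʳ (suc (suc k)) ⟩
    0                               ≡⟨ cong (1 *_) (k>n⇒nCk≡0 (s≤s (z≤n {k}))) ⟨
    1 * (0 C suc k)                 ∎
  [k+1]*[n+1]C[k+1]≡[n+1]*nCk (suc n) zero    = begin
    1 * (suc (suc n) C 1) ≡⟨ *-identityˡ _ ⟩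
    suc (suc n) C 1       ≡⟨ nC1≡n (suc (suc n)) ⟩
    suc (suc n)           ≡⟨ *-identityʳ (suc (suc n)) ⟨
    suc (suc n) * 1       ∎
  [k+1]*[n+1]C[k+1]≡[n+1]*nCk (suc n) (suc k) = begin
    suc (suc k) * (suc (suc n) C suc (suc k))
      ≡⟨ cong (suc (suc k) *_) (nCk+nC[k+1]≡[n+1]C[k+1] (suc n) (suc k)) ⟨
    suc (suc k) * (suc n C suc k + suc n C suc (suc k))
      ≡⟨ *-distribˡ-+ (suc (suc k)) (suc n C suc k) _ ⟩
    suc n C suc k + suc k * (suc n C suc k) + suc (suc k) * (suc n C suc (suc k))
      ≡⟨ cong₂ (λ a b → suc n C suc k + a + b) ([k+1]*[n+1]C[k+1]≡[n+1]*nCk n k) ([k+1]*[n+1]C[k+1]≡[n+1]*nCk n (suc k)) ⟩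
    suc n C suc k + suc n * (n C k) + suc n * (n C suc k)
      ≡⟨ +-assoc (suc n C suc k) _ _ ⟩
    suc n C suc k + (suc n * (n C k) + suc n * (n C suc k))
      ≡⟨ cong (suc n C suc k +_) (*-distribˡ-+ (suc n) (n C k) (n C suc k)) ⟨
    suc n C suc k + suc n * (n C k + n C suc k)
      ≡⟨ cong (λ c → suc n C suc k + suc n * c) (nCk+nC[k+1]≡[n+1]C[k+1] n k) ⟩
    suc (suc n) * (suc n C suc k) ∎

open import Data.Integer as ℤ using (ℤ; +_; 0ℤ; 1ℤ; _+_; _*_; _-_)
open import Data.Integer.Properties
  using (pos-+; pos-*; *-cancelˡ-≡; *-zeroʳ; +-identityˡ; +-identityʳ; +-assoc; +-comm; *-distribˡ-+)
open import Data.Integer.Tactic.RingSolver using (solve-∀; solve)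

Cℤ : ℕ → ℕ → ℤ
Cℤ n k = + (n C k)

Cℤ-absorb : ∀ n k → (1ℤ + + k) * Cℤ (suc n) (suc k) ≡ (1ℤ + + n) * Cℤ n k
Cℤ-absorb n k = begin
  + suc k * Cℤ (suc n) (suc k)  ≡⟨ pos-* (suc k) _ ⟨
  + (suc k ℕ.* (suc n C suc k)) ≡⟨ cong +_ ([k+1]*[n+1]C[k+1]≡[n+1]*nCk n k) ⟩
  + (suc n ℕ.* (n C k))         ≡⟨ pos-* (suc n) _ ⟩
  + suc n * Cℤ n k              ∎

Cℤ-pascal : ∀ n k → Cℤ n k + Cℤ n (suc k) ≡ Cℤ (suc n) (suc k)
Cℤ-pascal n k = trans (sym (pos-+ (n C k) _)) (cong +_ (nCk+nC[k+1]≡[n+1]C[k+1] n k))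

Cℤ-lower : ∀ n k → (1ℤ + + k) * Cℤ n (suc k) ≡ (+ n - + k) * Cℤ n k
Cℤ-lower n k = difference (+ n) (+ k) _ _ _ (Cℤ-pascal n k) (Cℤ-absorb n k)
  where
  difference : ∀ n k a b c → a + b ≡ c → (1ℤ + k) * c ≡ (1ℤ + n) * a → (1ℤ + k) * b ≡ (n - k) * a
  difference n k a b .(a + b) refl e = begin
    (1ℤ + k) * b                      ≡⟨ solve (n ∷ k ∷ a ∷ b ∷ []) ⟩
    (1ℤ + k) * (a + b) - (1ℤ + k) * a ≡⟨ cong (_- (1ℤ + k) * a) e ⟩
    (1ℤ + n) * a - (1ℤ + k) * a       ≡⟨ solve (n ∷ k ∷ a ∷ b ∷ []) ⟩
    (n - k) * a                       ∎

Cℤ-upper : ∀ n k → (1ℤ + + n - + k) * Cℤ (suc n) k ≡ (1ℤ + + n) * Cℤ n k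
Cℤ-upper n k = trans (sym (Cℤ-lower (suc n) k)) (Cℤ-absorb n k)

+[2*n]≡+n++n : ∀ n → + (2 ℕ.* n) ≡ + n + + n
+[2*n]≡+n++n n = trans (pos-+ n (n ℕ.+ 0)) (cong (λ m → + n + + m) (NP.+-identityʳ n))

Cℤ-central : ∀ n → (1ℤ + + n) * Cℤ (2 ℕ.* suc n) (suc n) ≡ + 2 * (1ℤ + + n + + n) * Cℤ (2 ℕ.* n) n
Cℤ-central n = *-cancelˡ-≡ (1ℤ + + n) _ _
  (scaled (+ n) (+ (2 ℕ.* n)) (Cℤ (2 ℕ.* suc n) (suc n)) (Cℤ (suc (2 ℕ.* n)) n) (Cℤ (2 ℕ.* n) n)
          (+[2*n]≡+n++n n) absorb-2n+1 (Cℤ-upper (2 ℕ.* n) n))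
  where
  scaled : ∀ n N c′ s c → N ≡ n + n → (1ℤ + n) * c′ ≡ (1ℤ + (1ℤ + N)) * s → (1ℤ + N - n) * s ≡ (1ℤ + N) * c →
           (1ℤ + n) * ((1ℤ + n) * c′) ≡ (1ℤ + n) * (+ 2 * (1ℤ + n + n) * c)
  scaled n .(n + n) c′ s c refl absorb upper = begin
    (1ℤ + n) * ((1ℤ + n) * c′)                    ≡⟨ cong ((1ℤ + n) *_) absorb ⟩
    (1ℤ + n) * ((1ℤ + (1ℤ + (n + n))) * s)        ≡⟨ solve (n ∷ s ∷ []) ⟩
    (+ 2 * (1ℤ + n)) * ((1ℤ + (n + n) - n) * s)   ≡⟨ cong ((+ 2 * (1ℤ + n)) *_) upper ⟩
    (+ 2 * (1ℤ + n)) * ((1ℤ + (n + n)) * c)       ≡⟨ solve (n ∷ c ∷ []) ⟩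
    (1ℤ + n) * (+ 2 * (1ℤ + n + n) * c)           ∎
  absorb-2n+1 : (1ℤ + + n) * Cℤ (2 ℕ.* suc n) (suc n) ≡ (1ℤ + (1ℤ + + (2 ℕ.* n))) * Cℤ (suc (2 ℕ.* n)) n
  absorb-2n+1 = subst (λ m → (1ℤ + + n) * Cℤ m (suc n) ≡ (1ℤ + (1ℤ + + (2 ℕ.* n))) * Cℤ (suc (2 ℕ.* n)) n)
                      (sym (NP.*-suc 2 n)) (Cℤ-absorb (suc (2 ℕ.* n)) n)

Cℤ-+-suc : ∀ a b → (1ℤ + + b) * Cℤ (a ℕ.+ suc b) a ≡ (1ℤ + + a + + b) * Cℤ (a ℕ.+ b) a
Cℤ-+-suc a b = shift (+ a) (+ b) (Cℤ (a ℕ.+ suc b) a) (Cℤ (a ℕ.+ b) a)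
  (subst (λ m → (1ℤ + + (a ℕ.+ b) - + a) * Cℤ m a ≡ (1ℤ + + (a ℕ.+ b)) * Cℤ (a ℕ.+ b) a)
         (sym (NP.+-suc a b)) (Cℤ-upper (a ℕ.+ b) a))
  where
  shift : ∀ a b X Y → (1ℤ + (a + b) - a) * X ≡ (1ℤ + (a + b)) * Y → (1ℤ + b) * X ≡ (1ℤ + a + b) * Y
  shift a b X Y e = begin
    (1ℤ + b) * X           ≡⟨ solve (a ∷ b ∷ X ∷ []) ⟩
    (1ℤ + (a + b) - a) * X ≡⟨ e ⟩
    (1ℤ + (a + b)) * Y     ≡⟨ solve (a ∷ b ∷ Y ∷ []) ⟩
    (1ℤ + a + b) * Y       ∎

hℤ : ℕ → ℕ → ℤ
hℤ n k = Cℤ (2 ℕ.* n) n * Cℤ (2 ℕ.* k) k * Cℤ (n ℕ.+ 2 ℕ.* k) n * Cℤ n k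

hℤ-suc-n : ∀ n k → (1ℤ + + n) * (1ℤ + + n - + k) * hℤ (suc n) k
                 ≡ + 2 * (1ℤ + + n + + n) * (1ℤ + + n + + k + + k) * hℤ n k
hℤ-suc-n n k = *-cancelˡ-≡ (1ℤ + + n) _ _
  (multiply (+ n) (+ k) (+ (2 ℕ.* k))
            (Cℤ (2 ℕ.* suc n) (suc n)) (Cℤ (2 ℕ.* n) n) (Cℤ (2 ℕ.* k) k)
            (Cℤ (suc n ℕ.+ 2 ℕ.* k) (suc n)) (Cℤ (n ℕ.+ 2 ℕ.* k) n) (Cℤ (suc n) k) (Cℤ n k)
            (+[2*n]≡+n++n k) (Cℤ-central n) (Cℤ-absorb (n ℕ.+ 2 ℕ.* k) n) (Cℤ-upper n k))
  where
  multiply : ∀ n k T c₁′ c₁ c₂ c₃′ c₃ c₄′ c₄ → T ≡ k + k →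
    (1ℤ + n) * c₁′ ≡ + 2 * (1ℤ + n + n) * c₁ → (1ℤ + n) * c₃′ ≡ (1ℤ + (n + T)) * c₃ → (1ℤ + n - k) * c₄′ ≡ (1ℤ + n) * c₄ →
    (1ℤ + n) * ((1ℤ + n) * (1ℤ + n - k) * (c₁′ * c₂ * c₃′ * c₄′))
      ≡ (1ℤ + n) * (+ 2 * (1ℤ + n + n) * (1ℤ + n + k + k) * (c₁ * c₂ * c₃ * c₄))
  multiply n k .(k + k) c₁′ c₁ c₂ c₃′ c₃ c₄′ c₄ refl e₁ e₃ e₄ = begin
    (1ℤ + n) * ((1ℤ + n) * (1ℤ + n - k) * (c₁′ * c₂ * c₃′ * c₄′))
      ≡⟨ solve (n ∷ k ∷ c₁′ ∷ c₂ ∷ c₃′ ∷ c₄′ ∷ []) ⟩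
    ((1ℤ + n) * c₁′) * c₂ * ((1ℤ + n) * c₃′) * ((1ℤ + n - k) * c₄′)
      ≡⟨ cong₂ _*_ (cong₂ _*_ (cong (_* c₂) e₁) e₃) e₄ ⟩
    (+ 2 * (1ℤ + n + n) * c₁) * c₂ * ((1ℤ + (n + (k + k))) * c₃) * ((1ℤ + n) * c₄)
      ≡⟨ solve (n ∷ k ∷ c₁ ∷ c₂ ∷ c₃ ∷ c₄ ∷ []) ⟩
    (1ℤ + n) * (+ 2 * (1ℤ + n + n) * (1ℤ + n + k + k) * (c₁ * c₂ * c₃ * c₄)) ∎

hℤ-suc-k : ∀ n k → (1ℤ + + k) * (1ℤ + + k) * (1ℤ + + k) * hℤ n (suc k)
                 ≡ (1ℤ + + n + + k + + k) * (+ 2 + + n + + k + + k) * (+ n - + k) * hℤ n k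
hℤ-suc-k n k = *-cancelˡ-≡ (+ 2 * (1ℤ + + k + + k)) _ _
  (multiply (+ n) (+ k) (+ (2 ℕ.* k))
            (Cℤ (2 ℕ.* n) n) (Cℤ (2 ℕ.* suc k) (suc k)) (Cℤ (2 ℕ.* k) k)
            (Cℤ (n ℕ.+ 2 ℕ.* suc k) n) (Cℤ (n ℕ.+ suc (2 ℕ.* k)) n) (Cℤ (n ℕ.+ 2 ℕ.* k) n) (Cℤ n (suc k)) (Cℤ n k)
            (+[2*n]≡+n++n k) (Cℤ-central k)
            (subst (λ m → (1ℤ + + suc (2 ℕ.* k)) * Cℤ (n ℕ.+ m) n ≡ (1ℤ + + n + + suc (2 ℕ.* k)) * Cℤ (n ℕ.+ suc (2 ℕ.* k)) n)
                   (sym (NP.*-suc 2 k)) (Cℤ-+-suc n (suc (2 ℕ.* k))))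
            (Cℤ-+-suc n (2 ℕ.* k)) (Cℤ-lower n k))
  where
  multiply : ∀ n k T c₁ c₂′ c₂ c₃″ c₃′ c₃ c₄′ c₄ → T ≡ k + k →
    (1ℤ + k) * c₂′ ≡ + 2 * (1ℤ + k + k) * c₂ →
    (1ℤ + (1ℤ + T)) * c₃″ ≡ (1ℤ + n + (1ℤ + T)) * c₃′ → (1ℤ + T) * c₃′ ≡ (1ℤ + n + T) * c₃ →
    (1ℤ + k) * c₄′ ≡ (n - k) * c₄ →
    + 2 * (1ℤ + k + k) * ((1ℤ + k) * (1ℤ + k) * (1ℤ + k) * (c₁ * c₂′ * c₃″ * c₄′))
      ≡ + 2 * (1ℤ + k + k) * ((1ℤ + n + k + k) * (+ 2 + n + k + k) * (n - k) * (c₁ * c₂ * c₃ * c₄))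
  multiply n k .(k + k) c₁ c₂′ c₂ c₃″ c₃′ c₃ c₄′ c₄ refl e₂ e₃″ e₃′ e₄ = begin
    + 2 * (1ℤ + k + k) * ((1ℤ + k) * (1ℤ + k) * (1ℤ + k) * (c₁ * c₂′ * c₃″ * c₄′))
      ≡⟨ solve (n ∷ k ∷ c₁ ∷ c₂′ ∷ c₃″ ∷ c₄′ ∷ []) ⟩
    c₁ * ((1ℤ + k) * c₂′) * ((1ℤ + (k + k)) * ((1ℤ + (1ℤ + (k + k))) * c₃″)) * ((1ℤ + k) * c₄′)
      ≡⟨ cong₂ _*_ (cong₂ _*_ (cong (c₁ *_) e₂) (cong ((1ℤ + (k + k)) *_) e₃″)) e₄ ⟩
    c₁ * (+ 2 * (1ℤ + k + k) * c₂) * ((1ℤ + (k + k)) * ((1ℤ + n + (1ℤ + (k + k))) * c₃′)) * ((n - k) * c₄)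
      ≡⟨ solve (n ∷ k ∷ c₁ ∷ c₂ ∷ c₃′ ∷ c₄ ∷ []) ⟩
    c₁ * (+ 2 * (1ℤ + k + k) * c₂) * ((1ℤ + n + (1ℤ + (k + k))) * ((1ℤ + (k + k)) * c₃′)) * ((n - k) * c₄)
      ≡⟨ cong (λ c → c₁ * (+ 2 * (1ℤ + k + k) * c₂) * ((1ℤ + n + (1ℤ + (k + k))) * c) * ((n - k) * c₄)) e₃′ ⟩
    c₁ * (+ 2 * (1ℤ + k + k) * c₂) * ((1ℤ + n + (1ℤ + (k + k))) * ((1ℤ + n + (k + k)) * c₃)) * ((n - k) * c₄)
      ≡⟨ solve (n ∷ k ∷ c₁ ∷ c₂ ∷ c₃ ∷ c₄ ∷ []) ⟩
    + 2 * (1ℤ + k + k) * ((1ℤ + n + k + k) * (+ 2 + n + k + k) * (n - k) * (c₁ * c₂ * c₃ * c₄)) ∎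

eliminate : ∀ {a₁ a₂ b₀ b₁ c₁ c₂ H₀ H₁ H₂} → a₁ * H₁ ≡ a₂ * H₂ → b₁ * H₁ ≡ b₀ * H₀ →
            (a₂ * b₁) * (c₂ * H₂ + c₁ * H₁) ≡ ((c₂ * a₁ + a₂ * c₁) * b₀) * H₀
eliminate {a₁} {a₂} {b₀} {b₁} {c₁} {c₂} {H₀} {H₁} {H₂} e₁ e₂ = begin
  (a₂ * b₁) * (c₂ * H₂ + c₁ * H₁)           ≡⟨ solve (a₂ ∷ b₁ ∷ c₁ ∷ c₂ ∷ H₁ ∷ H₂ ∷ []) ⟩
  b₁ * c₂ * (a₂ * H₂) + a₂ * c₁ * (b₁ * H₁) ≡⟨ cong (λ t → b₁ * c₂ * t + a₂ * c₁ * (b₁ * H₁)) e₁ ⟨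
  b₁ * c₂ * (a₁ * H₁) + a₂ * c₁ * (b₁ * H₁) ≡⟨ solve (a₁ ∷ a₂ ∷ b₁ ∷ c₁ ∷ c₂ ∷ H₁ ∷ []) ⟩
  (c₂ * a₁ + a₂ * c₁) * (b₁ * H₁)           ≡⟨ cong ((c₂ * a₁ + a₂ * c₁) *_) e₂ ⟩
  (c₂ * a₁ + a₂ * c₁) * (b₀ * H₀)           ≡⟨ solve (a₁ ∷ a₂ ∷ b₀ ∷ c₁ ∷ c₂ ∷ H₀ ∷ []) ⟩
  ((c₂ * a₁ + a₂ * c₁) * b₀) * H₀           ∎

P Q G : ℕ → ℕ → ℤ
P n k = hℤ n k * (+ 3 * + k - + 2 * + n)
Q n k = hℤ n k * (+ 4 + + 2 * + n + + 12 * + k)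
G n zero    = 0ℤ
G n (suc k) = + 6 * (1ℤ + + n + + k + + k) * (+ n - + k) * hℤ n k

wz-pair : ∀ n k → G n (suc k) + (1ℤ + + n + + k) * (Q n k + P (suc n) k) ≡ G (suc n) k
wz-pair n zero    = base (+ n) (hℤ n 0) (hℤ (suc n) 0) (hℤ-suc-n n 0)
  where
  base : ∀ x H₀ H₁ → (1ℤ + x) * (1ℤ + x - 0ℤ) * H₁ ≡ + 2 * (1ℤ + x + x) * (1ℤ + x + 0ℤ + 0ℤ) * H₀ →
         + 6 * (1ℤ + x + 0ℤ + 0ℤ) * (x - 0ℤ) * H₀ + (1ℤ + x + 0ℤ) * (H₀ * (+ 4 + + 2 * x + + 12 * 0ℤ) + H₁ * (+ 3 * 0ℤ - + 2 * (1ℤ + x))) ≡ 0ℤ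
  base x H₀ H₁ e = begin
    + 6 * (1ℤ + x + 0ℤ + 0ℤ) * (x - 0ℤ) * H₀ + (1ℤ + x + 0ℤ) * (H₀ * (+ 4 + + 2 * x + + 12 * 0ℤ) + H₁ * (+ 3 * 0ℤ - + 2 * (1ℤ + x)))
      ≡⟨ solve (x ∷ H₀ ∷ H₁ ∷ []) ⟩
    (1ℤ + x) * (+ 4 + + 8 * x) * H₀ - + 2 * ((1ℤ + x) * (1ℤ + x - 0ℤ) * H₁)
      ≡⟨ cong (λ t → (1ℤ + x) * (+ 4 + + 8 * x) * H₀ - + 2 * t) e ⟩
    (1ℤ + x) * (+ 4 + + 8 * x) * H₀ - + 2 * (+ 2 * (1ℤ + x + x) * (1ℤ + x + 0ℤ + 0ℤ) * H₀)
      ≡⟨ solve (x ∷ H₀ ∷ []) ⟩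
    0ℤ ∎
-- The multiplier clears the denominators of the ratios h(n,j+1)/h(n+1,j+1) and h(n+1,j+1)/h(n+1,j).
wz-pair n (suc j) = *-cancelˡ-≡ (+ 2 * (1ℤ + + n + + n) * (1ℤ + + n + + suc j + + suc j) * ((1ℤ + + j) * (1ℤ + + j) * (1ℤ + + j))) _ _
  (step (+ n) (+ j) (hℤ (suc n) j) (hℤ (suc n) (suc j)) (hℤ n (suc j)) (hℤ-suc-n n (suc j)) (hℤ-suc-k (suc n) j))
  where
  step : ∀ x y H₀ H₁ H₂ →
    (1ℤ + x) * (1ℤ + x - (1ℤ + y)) * H₁ ≡ + 2 * (1ℤ + x + x) * (1ℤ + x + (1ℤ + y) + (1ℤ + y)) * H₂ →
    (1ℤ + y) * (1ℤ + y) * (1ℤ + y) * H₁ ≡ (1ℤ + (1ℤ + x) + y + y) * (+ 2 + (1ℤ + x) + y + y) * ((1ℤ + x) - y) * H₀ →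
    + 2 * (1ℤ + x + x) * (1ℤ + x + (1ℤ + y) + (1ℤ + y)) * ((1ℤ + y) * (1ℤ + y) * (1ℤ + y))
      * (+ 6 * (1ℤ + x + (1ℤ + y) + (1ℤ + y)) * (x - (1ℤ + y)) * H₂
         + (1ℤ + x + (1ℤ + y)) * (H₂ * (+ 4 + + 2 * x + + 12 * (1ℤ + y)) + H₁ * (+ 3 * (1ℤ + y) - + 2 * (1ℤ + x))))
    ≡ + 2 * (1ℤ + x + x) * (1ℤ + x + (1ℤ + y) + (1ℤ + y)) * ((1ℤ + y) * (1ℤ + y) * (1ℤ + y))
      * (+ 6 * (1ℤ + (1ℤ + x) + y + y) * ((1ℤ + x) - y) * H₀)
  step x y H₀ H₁ H₂ e₁ e₂ = begin
    + 2 * (1ℤ + x + x) * (1ℤ + x + (1ℤ + y) + (1ℤ + y)) * ((1ℤ + y) * (1ℤ + y) * (1ℤ + y))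
      * (+ 6 * (1ℤ + x + (1ℤ + y) + (1ℤ + y)) * (x - (1ℤ + y)) * H₂
         + (1ℤ + x + (1ℤ + y)) * (H₂ * (+ 4 + + 2 * x + + 12 * (1ℤ + y)) + H₁ * (+ 3 * (1ℤ + y) - + 2 * (1ℤ + x))))
      ≡⟨ solve (x ∷ y ∷ H₁ ∷ H₂ ∷ []) ⟩
    + 2 * (1ℤ + x + x) * (1ℤ + x + (1ℤ + y) + (1ℤ + y)) * ((1ℤ + y) * (1ℤ + y) * (1ℤ + y))
      * ((+ 6 * (1ℤ + x + (1ℤ + y) + (1ℤ + y)) * (x - (1ℤ + y)) + (1ℤ + x + (1ℤ + y)) * (+ 4 + + 2 * x + + 12 * (1ℤ + y))) * H₂
         + (1ℤ + x + (1ℤ + y)) * (+ 3 * (1ℤ + y) - + 2 * (1ℤ + x)) * H₁)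
      ≡⟨ eliminate {a₁ = (1ℤ + x) * (1ℤ + x - (1ℤ + y))}
                   {a₂ = + 2 * (1ℤ + x + x) * (1ℤ + x + (1ℤ + y) + (1ℤ + y))}
                   {b₀ = (1ℤ + (1ℤ + x) + y + y) * (+ 2 + (1ℤ + x) + y + y) * ((1ℤ + x) - y)}
                   {b₁ = (1ℤ + y) * (1ℤ + y) * (1ℤ + y)}
                   {c₁ = (1ℤ + x + (1ℤ + y)) * (+ 3 * (1ℤ + y) - + 2 * (1ℤ + x))}
                   {c₂ = + 6 * (1ℤ + x + (1ℤ + y) + (1ℤ + y)) * (x - (1ℤ + y)) + (1ℤ + x + (1ℤ + y)) * (+ 4 + + 2 * x + + 12 * (1ℤ + y))}
                   {H₀} {H₁} {H₂} e₁ e₂ ⟩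
    ((+ 6 * (1ℤ + x + (1ℤ + y) + (1ℤ + y)) * (x - (1ℤ + y)) + (1ℤ + x + (1ℤ + y)) * (+ 4 + + 2 * x + + 12 * (1ℤ + y)))
        * ((1ℤ + x) * (1ℤ + x - (1ℤ + y)))
      + + 2 * (1ℤ + x + x) * (1ℤ + x + (1ℤ + y) + (1ℤ + y)) * ((1ℤ + x + (1ℤ + y)) * (+ 3 * (1ℤ + y) - + 2 * (1ℤ + x))))
      * ((1ℤ + (1ℤ + x) + y + y) * (+ 2 + (1ℤ + x) + y + y) * ((1ℤ + x) - y)) * H₀
      ≡⟨ solve (x ∷ y ∷ H₀ ∷ []) ⟩
    + 2 * (1ℤ + x + x) * (1ℤ + x + (1ℤ + y) + (1ℤ + y)) * ((1ℤ + y) * (1ℤ + y) * (1ℤ + y))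
      * (+ 6 * (1ℤ + (1ℤ + x) + y + y) * ((1ℤ + x) - y) * H₀) ∎

sumTo-cong : ∀ m {f g : ℕ → ℤ} → (∀ k → k ℕ.≤ m → f k ≡ g k) → sumTo m f ≡ sumTo m g
sumTo-cong zero    f≗g = f≗g 0 z≤n
sumTo-cong (suc m) f≗g = cong₂ _+_ (sumTo-cong m (λ k k≤m → f≗g k (NP.m≤n⇒m≤1+n k≤m))) (f≗g (suc m) NP.≤-refl)

sumTo-zero : ∀ m {f : ℕ → ℤ} → (∀ k → k ℕ.≤ m → f k ≡ 0ℤ) → sumTo m f ≡ 0ℤ
sumTo-zero zero    f≗0 = f≗0 0 z≤n
sumTo-zero (suc m) f≗0 = cong₂ _+_ (sumTo-zero m (λ k k≤m → f≗0 k (NP.m≤n⇒m≤1+n k≤m))) (f≗0 (suc m) NP.≤-refl)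

sumTo-tail : ∀ {j m} {f : ℕ → ℤ} → j ℕ.≤ m → (∀ k → j ℕ.< k → k ℕ.≤ m → f k ≡ 0ℤ) → sumTo m f ≡ sumTo j f
sumTo-tail {j} {m} j≤m f≗0 with NP.m≤n⇒m<n∨m≡n j≤m
... | inj₂ refl = refl
sumTo-tail {j} {suc m} {f} _ f≗0 | inj₁ (s≤s j≤m) = begin
  sumTo m f + f (suc m) ≡⟨ cong₂ _+_ (sumTo-tail j≤m (λ k j<k k≤m → f≗0 k j<k (NP.m≤n⇒m≤1+n k≤m))) (f≗0 (suc m) (s≤s j≤m) NP.≤-refl) ⟩
  sumTo j f + 0ℤ        ≡⟨ +-identityʳ (sumTo j f) ⟩
  sumTo j f             ∎

sumTo-shift : ∀ m (a b : ℕ → ℤ) → sumTo (suc m) (λ n → a n + b n) ≡ a 0 + sumTo m (λ t → b t + a (suc t)) + b (suc m)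
sumTo-shift zero    a b = regroup (a 0) (b 0) (a 1) (b 1)
  where
  regroup : ∀ w x y z → (w + x) + (y + z) ≡ w + (x + y) + z
  regroup = solve-∀
sumTo-shift (suc m) a b = begin
  sumTo (suc m) (λ n → a n + b n) + (a (2 ℕ.+ m) + b (2 ℕ.+ m))
    ≡⟨ cong (_+ (a (2 ℕ.+ m) + b (2 ℕ.+ m))) (sumTo-shift m a b) ⟩
  a 0 + sumTo m (λ t → b t + a (suc t)) + b (suc m) + (a (2 ℕ.+ m) + b (2 ℕ.+ m))
    ≡⟨ regroup (a 0) (sumTo m (λ t → b t + a (suc t))) (b (suc m)) (a (2 ℕ.+ m)) (b (2 ℕ.+ m)) ⟩
  a 0 + (sumTo m (λ t → b t + a (suc t)) + (b (suc m) + a (2 ℕ.+ m))) + b (2 ℕ.+ m) ∎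
  where
  regroup : ∀ w s x y z → w + s + x + (y + z) ≡ w + (s + (x + y)) + z
  regroup = solve-∀

sumTo-telescope : ∀ m (f F : ℕ → ℤ) → (∀ t → t ℕ.≤ m → F t + f t ≡ F (suc t)) → F 0 + sumTo m f ≡ F (suc m)
sumTo-telescope zero    f F step = step 0 z≤n
sumTo-telescope (suc m) f F step = begin
  F 0 + (sumTo m f + f (suc m)) ≡⟨ +-assoc (F 0) (sumTo m f) (f (suc m)) ⟨
  F 0 + sumTo m f + f (suc m)   ≡⟨ cong (_+ f (suc m)) (sumTo-telescope m f F (λ t t≤m → step t (NP.m≤n⇒m≤1+n t≤m))) ⟩
  F (suc m) + f (suc m)         ≡⟨ step (suc m) NP.≤-refl ⟩
  F (suc (suc m))               ∎

*-distribˡ-sumTo : ∀ m c (f : ℕ → ℤ) → c * sumTo m f ≡ sumTo m (λ t → c * f t)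
*-distribˡ-sumTo zero    c f = refl
*-distribˡ-sumTo (suc m) c f =
  trans (*-distribˡ-+ c (sumTo m f) (f (suc m))) (cong (_+ c * f (suc m)) (*-distribˡ-sumTo m c f))

+h≡hℤ : ∀ n k → + h n k ≡ hℤ n k
+h≡hℤ n k = begin
  + (c₁ ℕ.* c₂ ℕ.* c₃ ℕ.* c₄)       ≡⟨ pos-* (c₁ ℕ.* c₂ ℕ.* c₃) c₄ ⟩
  + (c₁ ℕ.* c₂ ℕ.* c₃) * + c₄       ≡⟨ cong (_* + c₄) (pos-* (c₁ ℕ.* c₂) c₃) ⟩
  + (c₁ ℕ.* c₂) * + c₃ * + c₄       ≡⟨ cong (λ c → c * + c₃ * + c₄) (pos-* c₁ c₂) ⟩
  + c₁ * + c₂ * + c₃ * + c₄         ∎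
  where
  c₁ = (2 ℕ.* n) C n
  c₂ = (2 ℕ.* k) C k
  c₃ = (n ℕ.+ 2 ℕ.* k) C n
  c₄ = n C k

+h*factorCoeff₀≡P : ∀ n k → + h n k * factorCoeff n k 0 ≡ P n k
+h*factorCoeff₀≡P n k = cong₂ _*_ (+h≡hℤ n k) (cong₂ _-_ (pos-* 3 k) (pos-* 2 n))

+h*factorCoeff₁≡Q : ∀ n k → + h n k * factorCoeff n k 1 ≡ Q n k
+h*factorCoeff₁≡Q n k = cong₂ _*_ (+h≡hℤ n k)
  (trans (pos-+ (4 ℕ.+ 2 ℕ.* n) (12 ℕ.* k)) (cong₂ (λ a b → + 4 + a + b) (pos-* 2 n) (pos-* 12 k)))

-- Q n k multiplies x^(n+k+1), so in degree n + d it appears as Q n (d - 1).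
Q↑ : ℕ → ℕ → ℤ
Q↑ n zero    = 0ℤ
Q↑ n (suc d) = Q n d

sumTo-h*factorCoeff : ∀ n d → sumTo d (λ k → + h n k * factorCoeff n k (d ∸ k)) ≡ P n d + Q↑ n d
sumTo-h*factorCoeff n zero = trans (+h*factorCoeff₀≡P n 0) (sym (+-identityʳ (P n 0)))
sumTo-h*factorCoeff n (suc zero) = trans (cong₂ _+_ (+h*factorCoeff₁≡Q n 0) (+h*factorCoeff₀≡P n 1)) (+-comm (Q n 0) (P n 1))
sumTo-h*factorCoeff n (suc (suc d)) = begin
  sumTo d f + f (suc d) + f (suc (suc d))
    ≡⟨ cong₂ (λ s q → s + q + f (suc (suc d))) (sumTo-zero d beyond-linear) (trans (cong (coeff (suc d)) (NP.m+n∸n≡m 1 d)) (+h*factorCoeff₁≡Q n (suc d))) ⟩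
  0ℤ + Q n (suc d) + f (suc (suc d))
    ≡⟨ cong₂ _+_ (+-identityˡ (Q n (suc d))) (trans (cong (coeff (suc (suc d))) (NP.n∸n≡0 d)) (+h*factorCoeff₀≡P n (suc (suc d)))) ⟩
  Q n (suc d) + P n (suc (suc d))
    ≡⟨ +-comm (Q n (suc d)) (P n (suc (suc d))) ⟩
  P n (suc (suc d)) + Q↑ n (suc (suc d)) ∎
  where
  coeff : ℕ → ℕ → ℤ
  coeff k e = + h n k * factorCoeff n k e
  f : ℕ → ℤ
  f k = coeff k (suc (suc d) ∸ k)
  beyond-linear : ∀ k → k ℕ.≤ d → f k ≡ 0ℤ
  beyond-linear k k≤d = trans (cong (coeff k) (NP.+-∸-assoc 2 k≤d)) (*-zeroʳ (+ h n k))

termCoeff-≤ : ∀ n k m → n ℕ.+ k ℕ.≤ m → termCoeff n k m ≡ + h n k * factorCoeff n k (m ∸ (n ℕ.+ k))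
termCoeff-≤ n k m n+k≤m with n ℕ.+ k ≤? m
... | yes _    = refl
... | no n+k≰m = contradiction n+k≤m n+k≰m

termCoeff-> : ∀ n k m → m ℕ.< n ℕ.+ k → termCoeff n k m ≡ 0ℤ
termCoeff-> n k m m<n+k with n ℕ.+ k ≤? m
... | yes n+k≤m = contradiction n+k≤m (NP.<⇒≱ m<n+k)
... | no _      = refl

sumTo-termCoeff : ∀ n d → sumTo (n ℕ.+ d) (λ k → termCoeff n k (n ℕ.+ d)) ≡ P n d + Q↑ n d
sumTo-termCoeff n d = begin
  sumTo (n ℕ.+ d) (λ k → termCoeff n k (n ℕ.+ d))
    ≡⟨ sumTo-tail (NP.m≤n+m d n) (λ k d<k _ → termCoeff-> n k (n ℕ.+ d) (NP.+-monoʳ-< n d<k)) ⟩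
  sumTo d (λ k → termCoeff n k (n ℕ.+ d))
    ≡⟨ sumTo-cong d (λ k k≤d → trans (termCoeff-≤ n k (n ℕ.+ d) (NP.+-monoʳ-≤ n k≤d))
                                      (cong (λ e → + h n k * factorCoeff n k e) (NP.[m+n]∸[m+o]≡n∸o n d k))) ⟩
  sumTo d (λ k → + h n k * factorCoeff n k (d ∸ k))
    ≡⟨ sumTo-h*factorCoeff n d ⟩
  P n d + Q↑ n d ∎

seriesCoeff-suc : ∀ m → seriesCoeff (suc m) ≡ P 0 (suc m) + sumTo m (λ t → Q t (m ∸ t) + P (suc t) (m ∸ t))
seriesCoeff-suc m = begin
  seriesCoeff (suc m)
    ≡⟨ sumTo-cong (suc m) (λ n n≤m → subst (λ M → sumTo M (λ k → termCoeff n k M) ≡ P n (suc m ∸ n) + Q↑ n (suc m ∸ n))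
                                             (NP.m+[n∸m]≡n n≤m) (sumTo-termCoeff n (suc m ∸ n))) ⟩
  sumTo (suc m) (λ n → P n (suc m ∸ n) + Q↑ n (suc m ∸ n))
    ≡⟨ sumTo-shift m (λ n → P n (suc m ∸ n)) (λ n → Q↑ n (suc m ∸ n)) ⟩
  P 0 (suc m) + sumTo m (λ t → Q↑ t (suc m ∸ t) + P (suc t) (m ∸ t)) + Q↑ (suc m) (m ∸ m)
    ≡⟨ cong₂ (λ s q → P 0 (suc m) + s + q)
             (sumTo-cong m (λ t t≤m → cong (λ d → Q↑ t d + P (suc t) (m ∸ t)) (NP.+-∸-assoc 1 t≤m)))
             (cong (Q↑ (suc m)) (NP.n∸n≡0 m)) ⟩
  P 0 (suc m) + sumTo m (λ t → Q t (m ∸ t) + P (suc t) (m ∸ t)) + 0ℤ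
    ≡⟨ +-identityʳ _ ⟩
  P 0 (suc m) + sumTo m (λ t → Q t (m ∸ t) + P (suc t) (m ∸ t)) ∎

hℤ-0-suc : ∀ k → hℤ 0 (suc k) ≡ 0ℤ
hℤ-0-suc k = *-zeroʳ (Cℤ 0 0 * Cℤ (2 ℕ.* suc k) (suc k) * Cℤ (2 ℕ.* suc k) 0)

+[1+m]*P₀≡G₀ : ∀ m → + suc m * P 0 (suc m) ≡ G 0 (suc m)
+[1+m]*P₀≡G₀ zero    = refl
+[1+m]*P₀≡G₀ (suc m) = begin
  + suc (suc m) * (hℤ 0 (suc (suc m)) * c)  ≡⟨ cong (λ x → + suc (suc m) * (x * c)) (hℤ-0-suc (suc m)) ⟩
  + suc (suc m) * (0ℤ * c)                  ≡⟨ *-zeroʳ (+ suc (suc m)) ⟩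
  0ℤ                                        ≡⟨ *-zeroʳ c′ ⟨
  c′ * 0ℤ                                   ≡⟨ cong (c′ *_) (hℤ-0-suc m) ⟨
  c′ * hℤ 0 (suc m)                         ∎
  where
  c = + 3 * + suc (suc m) - + 2 * + 0
  c′ = + 6 * (1ℤ + + 0 + + suc m + + suc m) * (+ 0 - + suc m)

wz-pair-on-diagonal : ∀ m t → t ℕ.≤ m → G t (suc m ∸ t) + + suc m * (Q t (m ∸ t) + P (suc t) (m ∸ t)) ≡ G (suc t) (m ∸ t)
wz-pair-on-diagonal m t t≤m = begin
  G t (suc m ∸ t) + + suc m * (Q t (m ∸ t) + P (suc t) (m ∸ t))
    ≡⟨ cong₂ (λ d c → G t d + + suc c * (Q t (m ∸ t) + P (suc t) (m ∸ t))) (NP.+-∸-assoc 1 t≤m) (sym (NP.m+[n∸m]≡n t≤m)) ⟩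
  G t (suc (m ∸ t)) + + suc (t ℕ.+ (m ∸ t)) * (Q t (m ∸ t) + P (suc t) (m ∸ t))
    ≡⟨ wz-pair t (m ∸ t) ⟩
  G (suc t) (m ∸ t) ∎

lemma2p2 : (m : ℕ) → seriesCoeff m ≡ 0ℤ
lemma2p2 zero    = refl
lemma2p2 (suc m) = *-cancelˡ-≡ (+ suc m) _ _ (begin
  + suc m * seriesCoeff (suc m)                       ≡⟨ cong (+ suc m *_) (seriesCoeff-suc m) ⟩
  + suc m * (P 0 (suc m) + sumTo m diagonal)          ≡⟨ *-distribˡ-+ (+ suc m) (P 0 (suc m)) (sumTo m diagonal) ⟩
  + suc m * P 0 (suc m) + + suc m * sumTo m diagonal  ≡⟨ cong₂ _+_ (+[1+m]*P₀≡G₀ m) (*-distribˡ-sumTo m (+ suc m) diagonal) ⟩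
  G 0 (suc m) + sumTo m (λ t → + suc m * diagonal t)  ≡⟨ sumTo-telescope m (λ t → + suc m * diagonal t) (λ t → G t (suc m ∸ t)) (wz-pair-on-diagonal m) ⟩
  G (suc m) (m ∸ m)                                   ≡⟨ cong (G (suc m)) (NP.n∸n≡0 m) ⟩
  0ℤ                                                  ≡⟨ *-zeroʳ (+ suc m) ⟨
  + suc m * 0ℤ                                        ∎)
  where
  diagonal : ℕ → ℤ
  diagonal t = Q t (m ∸ t) + P (suc t) (m ∸ t)
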